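{- Let $n$ be a context, let $P,P'\in\mathrm{Proc}(n)$, let $\vec a$ be an action sequence starting at $n$, let $R\in\mathrm{Proc}(n+|\vec a|)$ with a trace $P\xrightarrow{\vec a}R$, and suppose $P$ and $P'$ are related by a braiding, i.e. one of the following holds: (i) $n=\Gamma+2+\Delta$ for contexts $\Gamma,\Delta$ and $P\bowtie_\Delta P'$ (generalised free braid); (ii) $P\rtimes P'$ (generalised bound braid). Then there exist an action sequence $\vec a'$ starting at $n$ and a process $R'\in\mathrm{Proc}(n+|\vec a|)$ such that there is a trace $P'\xrightarrow{\vec a'}R'$ and, in case (i), $R\bowtie_{\Delta+|\vec a|}R'$, while in case (ii), $R\rtimes R'$.
   Context: Synchronous $\pi$-calculus with de Bruijn indices. Contexts $\Gamma$ are natural numbers; a name in $\Gamma$ is a natural number $x<\Gamma$. The set $\mathrm{Proc}(\Gamma)$ of processes closed by $\Gamma$ is defined inductively: $\mathbf{0}\in\mathrm{Proc}(\Gamma)$; if $x<\Gamma$ and $P\in\mathrm{Proc}(\Gamma+1)$ then $\mathsf{in}\,x.P\in\mathrm{Proc}(\Gamma)$ (input on $x$, binding index $0$ in $P$); if $x,y<\Gamma$ and $P\in\mathrm{Proc}(\Gamma)$ then $\overline{x}\langle y\rangle.P\in\mathrm{Proc}(\Gamma)$; if $P,Q\in\mathrm{Proc}(\Gamma)$ then $P+Q$ and $P\mid Q$ are in $\mathrm{Proc}(\Gamma)$; if $P\in\mathrm{Proc}(\Gamma+1)$ then $\nu P\in\mathrm{Proc}(\Gamma)$; if $P\in\mathrm{Proc}(\Gamma)$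 then $!P\in\mathrm{Proc}(\Gamma)$. Actions in $\Gamma$ are: bound actions $\mathsf{in}\,x$ (input) and $\overline{x}\langle\cdot\rangle$ (bound output) for $x<\Gamma$, and non-bound actions $\overline{x}\langle y\rangle$ (output) for $x,y<\Gamma$ and $\tau$. Set $|a|=1$ if $a$ is bound and $|a|=0$ otherwise. A renaming $\rho:\Gamma\to\Delta$ is any function $\{0,\dots,\Gamma-1\}\to\{0,\dots,\Delta-1\}$. Its lifting $\rho+1:\Gamma+1\to\Delta+1$ maps $0\mapsto0$ and $x+1\mapsto\rho(x)+1$; $\rho+n$ is the $n$-fold lifting. Renamings act on actions by renaming every name ($\rho\tau=\tau$), and on processes by: $\rho\mathbf{0}=\mathbf{0}$, $\rho(\mathsf{in}\,x.P)=\mathsf{in}\,\rho(x).((\rho+1)P)$, $\rho(\overline{x}\langle y\rangle.P)=\overline{\rho x}\langle\rho y\rangle.\rho P$, $\rho(P+Q)=\rho P+\rho Q$, $\rho(P\mid Q)=\rho P\mid\rho Q$, $\rho(\nu P)=\nu((\rho+1)P)$, $\rho(!P)=!\rho P$. Special renamings: $\mathsf{push}:\Gamma\to\Gamma+1$, $x\mapsto x+1$; for $y<\Gamma$, $\mathsf{pop}\,y:\Gamma+1\to\Gamma$, $0\mapsto y$, $x+1\mapsto x$; $\mathsf{swap}_\Gamma:\Gamma+2\to\Gamma+2$ exchanging $0$ and $1$ and fixing all $x\ge2$. Transitions: for $P\in\mathrm{Proc}(\Gamma)$, an action $a$ in $\Gamma$ and $R\in\mathrm{Proc}(\Gamma+|a|)$,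 the relation $P\xrightarrow{a}R$ is the least relation closed under the following rules ($b$ ranges over bound actions, $c$ over non-bound actions): $\mathsf{in}\,x.P\xrightarrow{\mathsf{in}\,x}P$; $\overline{x}\langle y\rangle.P\xrightarrow{\overline{x}\langle y\rangle}P$; if $P\xrightarrow{a}R$ then $P+Q\xrightarrow{a}R$; if $Q\xrightarrow{a}S$ then $P+Q\xrightarrow{a}S$; if $P\xrightarrow{c}R$ then $P\mid Q\xrightarrow{c}R\mid Q$; if $Q\xrightarrow{c}S$ then $P\mid Q\xrightarrow{c}P\mid S$; if $P\xrightarrow{b}R$ then $P\mid Q\xrightarrow{b}R\mid\mathsf{push}\,Q$; if $Q\xrightarrow{b}S$ then $P\mid Q\xrightarrow{b}\mathsf{push}\,P\mid S$; if $P\xrightarrow{\mathsf{in}\,x}R$ and $Q\xrightarrow{\overline{x}\langle y\rangle}S$ then $P\mid Q\xrightarrow{\tau}(\mathsf{pop}\,y)R\mid S$; symmetrically if $P\xrightarrow{\overline{x}\langle y\rangle}R$ and $Q\xrightarrow{\mathsf{in}\,x}S$ then $P\mid Q\xrightarrow{\tau}R\mid(\mathsf{pop}\,y)S$; if $P\xrightarrow{\overline{x+1}\langle 0\rangle}R$ then $\nu P\xrightarrow{\overline{x}\langle\cdot\rangle}R$; if $P\xrightarrow{\mathsf{in}\,x}R$ and $Q\xrightarrow{\overline{x}\langle\cdot\rangle}S$ then $P\mid Q\xrightarrow{\tau}\nu(R\mid S)$; symmetrically if $P\xrightarrow{\overline{x}\langle\cdot\rangle}R$ and $Q\xrightarrow{\mathsf{in}\,x}S$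 then $P\mid Q\xrightarrow{\tau}\nu(R\mid S)$; if $P\xrightarrow{\mathsf{push}\,c}R$ then $\nu P\xrightarrow{c}\nu R$; if $P\xrightarrow{\mathsf{push}\,b}R$ then $\nu P\xrightarrow{b}\nu(\mathsf{swap}\,R)$; if $P\mid !P\xrightarrow{a}R$ then $!P\xrightarrow{a}R$. Action sequences and traces: an action sequence starting at $\Gamma$ is either the empty sequence $\varepsilon_\Gamma$ or $a\cdot\vec a$ where $a$ is an action in $\Gamma$ and $\vec a$ is an action sequence starting at $\Gamma+|a|$; $|\vec a|$ is the sum of $|a|$ over the actions of $\vec a$. A trace $P\xrightarrow{\vec a}R$ is a finite sequence of composable transitions: $P\xrightarrow{\varepsilon_\Gamma}P$, and if $P\xrightarrow{a}R'$ and $R'\xrightarrow{\vec a}R$ then $P\xrightarrow{a\cdot\vec a}R$. Generalised free braid: for $P,R\in\mathrm{Proc}(\Gamma+2+\Delta)$, $P\bowtie_\Delta R$ iff $P=(\mathsf{swap}_\Gamma+\Delta)R$. Generalised bound braid: for $P,R\in\mathrm{Proc}(\Gamma)$, $P\rtimes R$ is defined inductively by: if $P,R\in\mathrm{Proc}(\Gamma+2)$ and $P=\mathsf{swap}\,R$ then $\nu\nu P\rtimes\nu\nu R$; $\mathbf{0}\rtimes\mathbf{0}$; $\mathsf{in}\,x.P\rtimes\mathsf{in}\,x.P$; $\overline{x}\langle y\rangle.P\rtimes\overline{x}\langle y\rangle.P$; if $P\rtimes R$ then $P+Q\rtimes R+Q$; if $Q\rtimes S$ then $P+Q\rtimes P+S$;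 if $P\rtimes R$ and $Q\rtimes S$ then $P\mid Q\rtimes R\mid S$; if $P\rtimes R$ then $\nu P\rtimes\nu R$; if $P\rtimes R$ then $!P\rtimes !R$. A braiding between two processes is a relation of one of these two kinds. -}

module Defs where

open import Data.Nat using (ℕ; zero; suc; _+_)
open import Data.Fin using (Fin; zero; suc)
open import Data.Product using (Σ)
open import Relation.Binary.PropositionalEquality using (_≡_; subst)

-- Contexts are natural numbers; Γ+1 is written suc Γ, and Γ+Δ (extension
-- on the right, i.e. Δ extra innermost binders) is written Δ + Γ so that
-- suc (Δ + Γ) = suc Δ + Γ holds definitionally.

Name : ℕ → Set
Name Γ = Fin Γ

data Proc (Γ : ℕ) : Set where
  𝟘    : Proc Γ
  inp  : Name Γ → Proc (suc Γ) → Proc Γ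
  out  : Name Γ → Name Γ → Proc Γ → Proc Γ
  _⊕_  : Proc Γ → Proc Γ → Proc Γ
  _∥_  : Proc Γ → Proc Γ → Proc Γ
  ν    : Proc (suc Γ) → Proc Γ
  !_   : Proc Γ → Proc Γ

-- Actions in Γ, indexed by |a| (1 for bound actions, 0 otherwise)
data Action (Γ : ℕ) : ℕ → Set where
  inA   : Name Γ → Action Γ 1
  boutA : Name Γ → Action Γ 1
  outA  : Name Γ → Name Γ → Action Γ 0
  τ     : Action Γ 0

Ren : ℕ → ℕ → Set
Ren Γ Δ = Fin Γ → Fin Δ

lift : ∀ {Γ Δ} → Ren Γ Δ → Ren (suc Γ) (suc Δ)
lift ρ zero    = zero
lift ρ (suc x) = suc (ρ x)

liftN : ∀ {Γ Δ} (n : ℕ) → Ren Γ Δ → Ren (n + Γ) (n + Δ)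
liftN zero    ρ = ρ
liftN (suc n) ρ = lift (liftN n ρ)

push : ∀ {Γ} → Ren Γ (suc Γ)
push x = suc x

pop : ∀ {Γ} → Name Γ → Ren (suc Γ) Γ
pop y zero    = y
pop y (suc x) = x

swap : ∀ {Γ} → Ren (suc (suc Γ)) (suc (suc Γ))
swap zero          = suc zero
swap (suc zero)    = zero
swap (suc (suc x)) = suc (suc x)

renA : ∀ {Γ Δ k} → Ren Γ Δ → Action Γ k → Action Δ k
renA ρ (inA x)    = inA (ρ x)
renA ρ (boutA x)  = boutA (ρ x)
renA ρ (outA x y) = outA (ρ x) (ρ y)
renA ρ τ          = τ

ren : ∀ {Γ Δ} → Ren Γ Δ → Proc Γ → Proc Δ
ren ρ 𝟘         = 𝟘
ren ρ (inp x P) = inp (ρ x) (ren (lift ρ) P)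
ren ρ (out x y P) = out (ρ x) (ρ y) (ren ρ P)
ren ρ (P ⊕ Q)   = ren ρ P ⊕ ren ρ Q
ren ρ (P ∥ Q)   = ren ρ P ∥ ren ρ Q
ren ρ (ν P)     = ν (ren (lift ρ) P)
ren ρ (! P)     = ! ren ρ P

data _—[_]→_ {Γ : ℕ} : ∀ {k} → Proc Γ → Action Γ k → Proc (k + Γ) → Set where
  t-in   : ∀ {x P} → inp x P —[ inA x ]→ P
  t-out  : ∀ {x y P} → out x y P —[ outA x y ]→ P
  t-sumˡ : ∀ {k} {a : Action Γ k} {P Q R} → P —[ a ]→ R → (P ⊕ Q) —[ a ]→ R
  t-sumʳ : ∀ {k} {a : Action Γ k} {P Q S} → Q —[ a ]→ S → (P ⊕ Q) —[ a ]→ S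
  t-parˡ : ∀ {c : Action Γ 0} {P Q R} → P —[ c ]→ R → (P ∥ Q) —[ c ]→ (R ∥ Q)
  t-parʳ : ∀ {c : Action Γ 0} {P Q S} → Q —[ c ]→ S → (P ∥ Q) —[ c ]→ (P ∥ S)
  t-bparˡ : ∀ {b : Action Γ 1} {P Q R} → P —[ b ]→ R → (P ∥ Q) —[ b ]→ (R ∥ ren push Q)
  t-bparʳ : ∀ {b : Action Γ 1} {P Q S} → Q —[ b ]→ S → (P ∥ Q) —[ b ]→ (ren push P ∥ S)
  t-commˡ : ∀ {x y P Q R S} → P —[ inA x ]→ R → Q —[ outA x y ]→ S →
            (P ∥ Q) —[ τ ]→ (ren (pop y) R ∥ S)
  t-commʳ : ∀ {x y P Q R S} → P —[ outA x y ]→ R → Q —[ inA x ]→ S →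
            (P ∥ Q) —[ τ ]→ (R ∥ ren (pop y) S)
  t-open : ∀ {x P R} → P —[ outA (suc x) zero ]→ R → ν P —[ boutA x ]→ R
  t-closeˡ : ∀ {x P Q R S} → P —[ inA x ]→ R → Q —[ boutA x ]→ S →
             (P ∥ Q) —[ τ ]→ ν (R ∥ S)
  t-closeʳ : ∀ {x P Q R S} → P —[ boutA x ]→ R → Q —[ inA x ]→ S →
             (P ∥ Q) —[ τ ]→ ν (R ∥ S)
  t-res  : ∀ {c : Action Γ 0} {P R} → P —[ renA push c ]→ R → ν P —[ c ]→ ν R
  t-bres : ∀ {b : Action Γ 1} {P R} → P —[ renA push b ]→ R → ν P —[ b ]→ ν (ren swap R)
  t-rep  : ∀ {k} {a : Action Γ k} {P R} → (P ∥ (! P)) —[ a ]→ R → (! P) —[ a ]→ R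

data ActSeq (Γ : ℕ) : ℕ → Set where
  ε   : ActSeq Γ Γ
  _·_ : ∀ {k Γ'} → Action Γ k → ActSeq (k + Γ) Γ' → ActSeq Γ Γ'

∣_∣ : ∀ {Γ Γ'} → ActSeq Γ Γ' → ℕ
∣ ε ∣ = 0
∣ _·_ {k} a as ∣ = k + ∣ as ∣

data Trace {Γ : ℕ} : ∀ {Γ'} → Proc Γ → ActSeq Γ Γ' → Proc Γ' → Set where
  tr-ε : ∀ {P} → Trace P ε P
  tr-· : ∀ {k Γ'} {a : Action Γ k} {as : ActSeq (k + Γ) Γ'} {P R' R} →
         P —[ a ]→ R' → Trace R' as R → Trace P (a · as) R

-- Generalised free braid:  P ⋈_Δ R  for P, R ∈ Proc (Γ + 2 + Δ)
-- (context Γ+2+Δ written Δ + suc (suc Γ)); membership of the ambient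
-- context m in that shape is witnessed by an equation.
FreeBraid : (Γ Δ : ℕ) → ∀ {m} → Proc m → Proc m → Set
FreeBraid Γ Δ {m} P R =
  Σ (Δ + suc (suc Γ) ≡ m) λ e →
    P ≡ ren (subst (λ j → Ren j j) e (liftN Δ (swap {Γ}))) R

data _⋊_ {Γ : ℕ} : Proc Γ → Proc Γ → Set where
  b-νν  : ∀ {P R : Proc (suc (suc Γ))} → P ≡ ren swap R → ν (ν P) ⋊ ν (ν R)
  b-𝟘   : 𝟘 ⋊ 𝟘
  b-in  : ∀ {x P} → inp x P ⋊ inp x P
  b-out : ∀ {x y P} → out x y P ⋊ out x y P
  b-sumˡ : ∀ {P Q R} → P ⋊ R → (P ⊕ Q) ⋊ (R ⊕ Q)
  b-sumʳ : ∀ {P Q S} → Q ⋊ S → (P ⊕ Q) ⋊ (P ⊕ S)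
  b-par : ∀ {P Q R S} → P ⋊ R → Q ⋊ S → (P ∥ Q) ⋊ (R ∥ S)
  b-ν   : ∀ {P R : Proc (suc Γ)} → P ⋊ R → ν P ⋊ ν R
  b-!   : ∀ {P R} → P ⋊ R → (! P) ⋊ (! R)

module Submission where

open import Defs
open import Algebra.Definitions using (Involutive)
open import Data.Nat using (ℕ; zero; suc; _+_)
open import Data.Nat.Properties using (+-comm; +-assoc; +-identityʳ)
open import Data.Fin using (zero; suc)
open import Data.Product using (Σ; ∃-syntax; ∃₂; _×_; _,_)
open import Function using (id; _∘_)
open import Relation.Binary.PropositionalEquality
  using (_≡_; _≗_; refl; sym; trans; cong; cong₂; subst; module ≡-Reasoning)

-- A free braid is undone by renaming the whole trace with the involution
-- swap, lifted under every binder the trace crosses.  A bound braid is a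
-- simulation: each step of one side is matched, with the same label, by a
-- step of the other side into a bound-braided pair.  The only real work is
-- at ν ν P ⋊ ν ν (swap P), where extruding the inner binder is matched by
-- extruding the outer one.

private
  variable
    Γ Δ Δ' Θ k : ℕ

lift-cong : {f g : Ren Γ Δ} → f ≗ g → lift f ≗ lift g
lift-cong e zero    = refl
lift-cong e (suc x) = cong suc (e x)

ren-cong : {f g : Ren Γ Δ} → f ≗ g → ren f ≗ ren g
ren-cong e 𝟘           = refl
ren-cong e (inp x P)   = cong₂ inp (e x) (ren-cong (lift-cong e) P)
ren-cong e (out x y P) rewrite e x | e y = cong (out _ _) (ren-cong e P)
ren-cong e (P ⊕ Q)     = cong₂ _⊕_ (ren-cong e P) (ren-cong e Q)
ren-cong e (P ∥ Q)     = cong₂ _∥_ (ren-cong e P) (ren-cong e Q)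
ren-cong e (ν P)       = cong ν (ren-cong (lift-cong e) P)
ren-cong e (! P)       = cong !_ (ren-cong e P)

lift-∘ : {f : Ren Δ Θ} {g : Ren Γ Δ} {h : Ren Γ Θ} →
         f ∘ g ≗ h → lift f ∘ lift g ≗ lift h
lift-∘ e zero    = refl
lift-∘ e (suc x) = cong suc (e x)

ren-∘ : {f : Ren Δ Θ} {g : Ren Γ Δ} {h : Ren Γ Θ} →
        f ∘ g ≗ h → ren f ∘ ren g ≗ ren h
ren-∘ e 𝟘           = refl
ren-∘ e (inp x P)   = cong₂ inp (e x) (ren-∘ (lift-∘ e) P)
ren-∘ e (out x y P) rewrite e x | e y = cong (out _ _) (ren-∘ e P)
ren-∘ e (P ⊕ Q)     = cong₂ _⊕_ (ren-∘ e P) (ren-∘ e Q)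
ren-∘ e (P ∥ Q)     = cong₂ _∥_ (ren-∘ e P) (ren-∘ e Q)
ren-∘ e (ν P)       = cong ν (ren-∘ (lift-∘ e) P)
ren-∘ e (! P)       = cong !_ (ren-∘ e P)

ren-fuse : (f : Ren Δ Θ) (g : Ren Γ Δ) → ren f ∘ ren g ≗ ren (f ∘ g)
ren-fuse f g = ren-∘ (λ _ → refl)

ren-square : {f : Ren Δ Θ} {g : Ren Γ Δ} {f' : Ren Δ' Θ} {g' : Ren Γ Δ'} →
             f ∘ g ≗ f' ∘ g' → ren f ∘ ren g ≗ ren f' ∘ ren g'
ren-square {f' = f'} {g'} e P = trans (ren-∘ e P) (sym (ren-fuse f' g' P))

lift-id : {f : Ren Γ Γ} → f ≗ id → lift f ≗ id
lift-id e zero    = refl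
lift-id e (suc x) = cong suc (e x)

ren-id : {f : Ren Γ Γ} → f ≗ id → ren f ≗ id
ren-id e 𝟘           = refl
ren-id e (inp x P)   = cong₂ inp (e x) (ren-id (lift-id e) P)
ren-id e (out x y P) rewrite e x | e y = cong (out _ _) (ren-id e P)
ren-id e (P ⊕ Q)     = cong₂ _⊕_ (ren-id e P) (ren-id e Q)
ren-id e (P ∥ Q)     = cong₂ _∥_ (ren-id e P) (ren-id e Q)
ren-id e (ν P)       = cong ν (ren-id (lift-id e) P)
ren-id e (! P)       = cong !_ (ren-id e P)

ren-involutive : {f : Ren Γ Γ} → Involutive _≡_ f → Involutive _≡_ (ren f)
ren-involutive {f = f} inv P = trans (ren-fuse f f P) (ren-id inv P)

swap-involutive : Involutive _≡_ (swap {Γ})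
swap-involutive zero          = refl
swap-involutive (suc zero)    = refl
swap-involutive (suc (suc x)) = refl

lift-involutive : {f : Ren Γ Γ} → Involutive _≡_ f → Involutive _≡_ (lift f)
lift-involutive inv zero    = refl
lift-involutive inv (suc x) = cong suc (inv x)

liftN-involutive : {f : Ren Γ Γ} (n : ℕ) → Involutive _≡_ f → Involutive _≡_ (liftN n f)
liftN-involutive zero    inv = inv
liftN-involutive (suc n) inv = lift-involutive (liftN-involutive n inv)

swap-lift² : (ρ : Ren Γ Δ) → swap ∘ lift (lift ρ) ≗ lift (lift ρ) ∘ swap
swap-lift² ρ zero          = refl
swap-lift² ρ (suc zero)    = refl
swap-lift² ρ (suc (suc x)) = refl

pop-lift : (ρ : Ren Γ Δ) (y : Name Γ) → pop (ρ y) ∘ lift ρ ≗ ρ ∘ pop y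
pop-lift ρ y zero    = refl
pop-lift ρ y (suc x) = refl

-- The braid relation s₁s₂s₁ = s₂s₁s₂ on three strands, rearranged.
swap-yang-baxter : swap ∘ lift swap ∘ swap ∘ lift swap ≗ lift (swap {Γ}) ∘ swap
swap-yang-baxter zero                = refl
swap-yang-baxter (suc zero)          = refl
swap-yang-baxter (suc (suc zero))    = refl
swap-yang-baxter (suc (suc (suc x))) = refl

ren-swap-yang-baxter : (Y : Proc (3 + Γ)) →
  ren (lift swap) (ren swap Y) ≡ ren swap (ren (lift swap) (ren swap (ren (lift swap) Y)))
ren-swap-yang-baxter Y = begin
  ren (lift swap) (ren swap Y)
    ≡⟨ ren-fuse (lift swap) swap Y ⟩
  ren (lift swap ∘ swap) Y
    ≡⟨ ren-∘ swap-yang-baxter Y ⟨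
  ren swap (ren (lift swap ∘ swap ∘ lift swap) Y)
    ≡⟨ cong (ren swap) (ren-fuse (lift swap) (swap ∘ lift swap) Y) ⟨
  ren swap (ren (lift swap) (ren (swap ∘ lift swap) Y))
    ≡⟨ cong (ren swap ∘ ren (lift swap)) (ren-fuse swap (lift swap) Y) ⟨
  ren swap (ren (lift swap) (ren swap (ren (lift swap) Y))) ∎
  where open ≡-Reasoning

renA-lift-push : (ρ : Ren Γ Δ) (a : Action Γ k) →
                 renA (lift ρ) (renA push a) ≡ renA push (renA ρ a)
renA-lift-push ρ (inA x)    = refl
renA-lift-push ρ (boutA x)  = refl
renA-lift-push ρ (outA x y) = refl
renA-lift-push ρ τ          = refl

renA-swap-push² : (a : Action Γ k) → renA swap (renA push (renA push a)) ≡ renA push (renA push a)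
renA-swap-push² (inA x)    = refl
renA-swap-push² (boutA x)  = refl
renA-swap-push² (outA x y) = refl
renA-swap-push² τ          = refl

retarget : ∀ {P : Proc Γ} {a : Action Γ k} {X Y} → P —[ a ]→ X → X ≡ Y → P —[ a ]→ Y
retarget d refl = d

relabel : ∀ {P : Proc Γ} {a a' : Action Γ k} {X} → P —[ a ]→ X → a ≡ a' → P —[ a' ]→ X
relabel d refl = d

ren-step : ∀ {P : Proc Γ} {a : Action Γ k} {X} (ρ : Ren Γ Δ) →
           P —[ a ]→ X → ren ρ P —[ renA ρ a ]→ ren (liftN k ρ) X
ren-step ρ t-in           = t-in
ren-step ρ t-out          = t-out
ren-step ρ (t-sumˡ d)     = t-sumˡ (ren-step ρ d)
ren-step ρ (t-sumʳ d)     = t-sumʳ (ren-step ρ d)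
ren-step ρ (t-parˡ d)     = t-parˡ (ren-step ρ d)
ren-step ρ (t-parʳ d)     = t-parʳ (ren-step ρ d)
ren-step ρ (t-bparˡ {Q = Q} d) =
  retarget (t-bparˡ (ren-step ρ d)) (cong (_ ∥_) (ren-square (λ _ → refl) Q))
ren-step ρ (t-bparʳ {P = P} d) =
  retarget (t-bparʳ (ren-step ρ d)) (cong (_∥ _) (ren-square (λ _ → refl) P))
ren-step ρ (t-commˡ {y = y} {R = R} d e) =
  retarget (t-commˡ (ren-step ρ d) (ren-step ρ e)) (cong (_∥ _) (ren-square (pop-lift ρ y) R))
ren-step ρ (t-commʳ {y = y} {S = S} d e) =
  retarget (t-commʳ (ren-step ρ d) (ren-step ρ e)) (cong (_ ∥_) (ren-square (pop-lift ρ y) S))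
ren-step ρ (t-open d)     = t-open (ren-step (lift ρ) d)
ren-step ρ (t-closeˡ d e) = t-closeˡ (ren-step ρ d) (ren-step ρ e)
ren-step ρ (t-closeʳ d e) = t-closeʳ (ren-step ρ d) (ren-step ρ e)
ren-step ρ (t-res {c = c} d) =
  t-res (relabel (ren-step (lift ρ) d) (renA-lift-push ρ c))
ren-step ρ (t-bres {b = b} {R = R} d) =
  retarget (t-bres (relabel (ren-step (lift ρ) d) (renA-lift-push ρ b)))
           (cong ν (ren-square (swap-lift² ρ) R))
ren-step ρ (t-rep d)      = t-rep (ren-step ρ d)

-- Endo-renamings only: an action sequence fixes its final context.
renSeq : ∀ {Γ'} → Ren Γ Γ → ActSeq Γ Γ' → ActSeq Γ Γ'
renSeq ρ ε              = ε
renSeq ρ (_·_ {k} a as) = renA ρ a · renSeq (liftN k ρ) as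

liftAlong : ∀ {Γ'} → ActSeq Γ Γ' → Ren Γ Γ → Ren Γ' Γ'
liftAlong ε              ρ = ρ
liftAlong (_·_ {k} a as) ρ = liftAlong as (liftN k ρ)

ren-trace : ∀ {Γ'} {P : Proc Γ} {as : ActSeq Γ Γ'} {R} (ρ : Ren Γ Γ) →
            Trace P as R → Trace (ren ρ P) (renSeq ρ as) (ren (liftAlong as ρ) R)
ren-trace ρ tr-ε            = tr-ε
ren-trace ρ (tr-· {k} d tr) = tr-· (ren-step ρ d) (ren-trace (liftN k ρ) tr)

involution-trace : ∀ {Γ'} {σ : Ren Γ Γ} {P P' : Proc Γ} {as : ActSeq Γ Γ'} {R} →
                   Involutive _≡_ σ → P ≡ ren σ P' → Trace P as R →
                   Trace P' (renSeq σ as) (ren (liftAlong as σ) R)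
involution-trace {σ = σ} {P' = P'} inv refl tr =
  subst (λ Q → Trace Q _ _) (ren-involutive inv P') (ren-trace σ tr)

IsBraidSwap : (Γ Δ : ℕ) {m : ℕ} → Ren m m → Set
IsBraidSwap Γ Δ {m} ρ =
  Σ (Δ + suc (suc Γ) ≡ m) λ e → ρ ≗ subst (λ j → Ren j j) e (liftN Δ swap)

IsBraidSwap-lift : ∀ {m} {ρ : Ren m m} → IsBraidSwap Γ Δ ρ → IsBraidSwap Γ (suc Δ) (lift ρ)
IsBraidSwap-lift (refl , e) = refl , lift-cong e

IsBraidSwap-liftN : ∀ {m} {ρ : Ren m m} n → IsBraidSwap Γ Δ ρ → IsBraidSwap Γ (n + Δ) (liftN n ρ)
IsBraidSwap-liftN zero    s = s
IsBraidSwap-liftN (suc n) s = IsBraidSwap-lift (IsBraidSwap-liftN n s)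

IsBraidSwap-liftAlong : ∀ {n m} (as : ActSeq n m) {ρ : Ren n n} →
                        IsBraidSwap Γ Δ ρ → IsBraidSwap Γ (Δ + ∣ as ∣) (liftAlong as ρ)
IsBraidSwap-liftAlong {Γ} {Δ} ε {ρ} s =
  subst (λ D → IsBraidSwap Γ D ρ) (sym (+-identityʳ Δ)) s
IsBraidSwap-liftAlong {Γ} {Δ} (_·_ {k} a as) {ρ} s =
  subst (λ D → IsBraidSwap Γ D (liftAlong as (liftN k ρ)))
        (trans (cong (_+ ∣ as ∣) (+-comm k Δ)) (+-assoc Δ k ∣ as ∣))
        (IsBraidSwap-liftAlong as (IsBraidSwap-liftN k s))

IsBraidSwap-involutive : ∀ {m} {ρ : Ren m m} → IsBraidSwap Γ Δ ρ → Involutive _≡_ ρ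
IsBraidSwap-involutive {Δ = Δ} {ρ = ρ} (refl , e) x =
  trans (cong ρ (e x)) (trans (e _) (liftN-involutive Δ swap-involutive x))

IsBraidSwap⇒FreeBraid : ∀ {m} {ρ : Ren m m} {P R : Proc m} →
                        IsBraidSwap Γ Δ ρ → P ≡ ren ρ R → FreeBraid Γ Δ P R
IsBraidSwap⇒FreeBraid {R = R} (e , ρ≗) P≡ρR = e , trans P≡ρR (ren-cong ρ≗ R)

free-braid-trace : ∀ {n m} {P P' : Proc n} {as : ActSeq n m} {R : Proc m} →
                   Trace P as R → FreeBraid Γ Δ P P' →
                   ∃₂ λ as' R' → Trace P' as' R' × FreeBraid Γ (Δ + ∣ as ∣) R R'
free-braid-trace {Γ} {Δ} {as = as} {R} tr (refl , P≡σP') =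
  renSeq σ as , ren σ⁺ R ,
  involution-trace (liftN-involutive Δ swap-involutive) P≡σP' tr ,
  IsBraidSwap⇒FreeBraid σ⁺-swap (sym (ren-involutive (IsBraidSwap-involutive σ⁺-swap) R))
  where
  σ = liftN Δ (swap {Γ})
  σ⁺ = liftAlong as σ
  σ⁺-swap : IsBraidSwap Γ (Δ + ∣ as ∣) σ⁺
  σ⁺-swap = IsBraidSwap-liftAlong as (refl , λ _ → refl)

⋊-refl : (P : Proc Γ) → P ⋊ P
⋊-refl 𝟘           = b-𝟘
⋊-refl (inp x P)   = b-in
⋊-refl (out x y P) = b-out
⋊-refl (P ⊕ Q)     = b-sumˡ (⋊-refl P)
⋊-refl (P ∥ Q)     = b-par (⋊-refl P) (⋊-refl Q)
⋊-refl (ν P)       = b-ν (⋊-refl P)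
⋊-refl (! P)       = b-! (⋊-refl P)

ren-⋊ : {P P' : Proc Γ} (ρ : Ren Γ Δ) → P ⋊ P' → ren ρ P ⋊ ren ρ P'
ren-⋊ ρ (b-νν {R = R} refl) = b-νν (ren-square (sym ∘ swap-lift² ρ) R)
ren-⋊ ρ b-𝟘            = b-𝟘
ren-⋊ ρ b-in           = b-in
ren-⋊ ρ b-out          = b-out
ren-⋊ ρ (b-sumˡ h)     = b-sumˡ (ren-⋊ ρ h)
ren-⋊ ρ (b-sumʳ h)     = b-sumʳ (ren-⋊ ρ h)
ren-⋊ ρ (b-par h h')   = b-par (ren-⋊ ρ h) (ren-⋊ ρ h')
ren-⋊ ρ (b-ν h)        = b-ν (ren-⋊ (lift ρ) h)
ren-⋊ ρ (b-! h)        = b-! (ren-⋊ ρ h)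

BraidedStep : Proc Γ → Action Γ k → Proc (k + Γ) → Set
BraidedStep P' a X = ∃[ X' ] P' —[ a ]→ X' × X ⋊ X'

-- The inner transitions are taken at an arbitrary label a' with an equation,
-- since Agda cannot unify a' with renA push c directly.
module νν-Simulation {P R : Proc (suc (suc Γ))} (P≡swapR : P ≡ ren swap R) where

  R≡swapP : R ≡ ren swap P
  R≡swapP = trans (sym (ren-involutive swap-involutive R)) (cong (ren swap) (sym P≡swapR))

  swap-step : ∀ {a : Action (suc (suc Γ)) k} {Y} →
              P —[ a ]→ Y → R —[ renA swap a ]→ ren (liftN k swap) Y
  swap-step d = subst (λ Q → Q —[ _ ]→ _) (sym R≡swapP) (ren-step swap d)

  via-res : (c : Action Γ 0) {a' : Action (suc Γ) 0} {Z : Proc (suc Γ)} →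
            ν P —[ a' ]→ Z → a' ≡ renA push c → BraidedStep (ν (ν R)) c (ν Z)
  via-res c (t-res {R = Y} d) refl =
    _ , t-res (t-res (relabel (swap-step d) (renA-swap-push² c))) ,
    b-νν (sym (ren-involutive swap-involutive Y))

  via-bres : (b : Action Γ 1) {a' : Action (suc Γ) 1} {Z : Proc (suc (suc Γ))} →
             ν P —[ a' ]→ Z → a' ≡ renA push b → BraidedStep (ν (ν R)) b (ν (ren swap Z))
  via-bres b (t-bres {R = Y} d) refl =
    _ , t-bres (t-bres (relabel (swap-step d) (renA-swap-push² b))) ,
    b-νν (ren-swap-yang-baxter Y)

  -- P extrudes the inner binder; R extrudes its outer one, which is the same name.
  via-bres (boutA x) (t-open d) refl = _ , t-open (t-res (swap-step d)) , ⋊-refl _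

  via-open : (x : Name Γ) {a' : Action (suc Γ) 0} {Z : Proc (suc Γ)} →
             ν P —[ a' ]→ Z → a' ≡ outA (suc x) zero → BraidedStep (ν (ν R)) (boutA x) Z
  via-open x (t-res {R = Y} d) refl =
    _ , t-bres (t-open (swap-step d)) ,
    b-ν (subst (Y ⋊_) (sym (ren-involutive swap-involutive Y)) (⋊-refl Y))

  simulate : ∀ {a : Action Γ k} {X} → ν (ν P) —[ a ]→ X → BraidedStep (ν (ν R)) a X
  simulate (t-res {c = c} d)  = via-res c d refl
  simulate (t-bres {b = b} d) = via-bres b d refl
  simulate (t-open {x = x} d) = via-open x d refl

⋊-simulate : ∀ {P P' : Proc Γ} {a : Action Γ k} {X} → P ⋊ P' → P —[ a ]→ X → BraidedStep P' a X
⋊-simulate (b-νν e) d = νν-Simulation.simulate e d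
⋊-simulate b-in  t-in  = _ , t-in , ⋊-refl _
⋊-simulate b-out t-out = _ , t-out , ⋊-refl _
⋊-simulate (b-sumˡ h) (t-sumˡ d) = let X' , d' , h' = ⋊-simulate h d in X' , t-sumˡ d' , h'
⋊-simulate (b-sumˡ h) (t-sumʳ d) = _ , t-sumʳ d , ⋊-refl _
⋊-simulate (b-sumʳ h) (t-sumˡ d) = _ , t-sumˡ d , ⋊-refl _
⋊-simulate (b-sumʳ h) (t-sumʳ d) = let X' , d' , h' = ⋊-simulate h d in X' , t-sumʳ d' , h'
⋊-simulate (b-par h₁ h₂) (t-parˡ d) =
  let _ , d' , h' = ⋊-simulate h₁ d in _ , t-parˡ d' , b-par h' h₂
⋊-simulate (b-par h₁ h₂) (t-parʳ d) =
  let _ , d' , h' = ⋊-simulate h₂ d in _ , t-parʳ d' , b-par h₁ h'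
⋊-simulate (b-par h₁ h₂) (t-bparˡ d) =
  let _ , d' , h' = ⋊-simulate h₁ d in _ , t-bparˡ d' , b-par h' (ren-⋊ push h₂)
⋊-simulate (b-par h₁ h₂) (t-bparʳ d) =
  let _ , d' , h' = ⋊-simulate h₂ d in _ , t-bparʳ d' , b-par (ren-⋊ push h₁) h'
⋊-simulate (b-par h₁ h₂) (t-commˡ {y = y} d e) =
  let _ , d' , h' = ⋊-simulate h₁ d ; _ , e' , k' = ⋊-simulate h₂ e
  in _ , t-commˡ d' e' , b-par (ren-⋊ (pop y) h') k'
⋊-simulate (b-par h₁ h₂) (t-commʳ {y = y} d e) =
  let _ , d' , h' = ⋊-simulate h₁ d ; _ , e' , k' = ⋊-simulate h₂ e
  in _ , t-commʳ d' e' , b-par h' (ren-⋊ (pop y) k')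
⋊-simulate (b-par h₁ h₂) (t-closeˡ d e) =
  let _ , d' , h' = ⋊-simulate h₁ d ; _ , e' , k' = ⋊-simulate h₂ e
  in _ , t-closeˡ d' e' , b-ν (b-par h' k')
⋊-simulate (b-par h₁ h₂) (t-closeʳ d e) =
  let _ , d' , h' = ⋊-simulate h₁ d ; _ , e' , k' = ⋊-simulate h₂ e
  in _ , t-closeʳ d' e' , b-ν (b-par h' k')
⋊-simulate (b-ν h) (t-open d) = let _ , d' , h' = ⋊-simulate h d in _ , t-open d' , h'
⋊-simulate (b-ν h) (t-res d)  = let _ , d' , h' = ⋊-simulate h d in _ , t-res d' , b-ν h'
⋊-simulate (b-ν h) (t-bres d) =
  let _ , d' , h' = ⋊-simulate h d in _ , t-bres d' , b-ν (ren-⋊ swap h')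
⋊-simulate (b-! h) (t-rep d) =
  let _ , d' , h' = ⋊-simulate (b-par h (b-! h)) d in _ , t-rep d' , h'

⋊-trace : ∀ {n m} {P P' : Proc n} {as : ActSeq n m} {R : Proc m} →
          Trace P as R → P ⋊ P' → ∃[ R' ] Trace P' as R' × R ⋊ R'
⋊-trace tr-ε        h = _ , tr-ε , h
⋊-trace (tr-· d tr) h =
  let _ , d' , h' = ⋊-simulate h d ; R' , tr' , h'' = ⋊-trace tr h'
  in R' , tr-· d' tr' , h''

lemma4p7 : ∀ {n m} (P P' : Proc n) (as : ActSeq n m) (R : Proc m) →
    Trace P as R →
    ((Γ Δ : ℕ) → FreeBraid Γ Δ P P' →
       Σ (ActSeq n m) λ as' → Σ (Proc m) λ R' →
         Trace P' as' R' × FreeBraid Γ (Δ + ∣ as ∣) R R')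
    × (P ⋊ P' →
       Σ (ActSeq n m) λ as' → Σ (Proc m) λ R' →
         Trace P' as' R' × (R ⋊ R'))
lemma4p7 P P' as R tr =
  (λ Γ Δ → free-braid-trace tr) ,
  (λ h → let R' , tr' , h' = ⋊-trace tr h in as , R' , tr' , h')
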